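{- For any strong specification command $[q] = \sqcap_{(t_1,t_2)\in q} t_1;\mathbf{term};t_2$ (with $q$ a set of pairs of tests), $[q] \Cap \mathbf{term} = [q]$ and $[q] \parallel \mathbf{term} = [q]$.
   Context: Commands form a complete distributive lattice under refinement ($\sqcap$ nondeterministic choice, $\sqcup$ conjunction, $\top$ infeasible, $\bot$ abort); $;$ is sequential composition with identity $\mathbf{nil}$; $c^\star=\nu x.\,\mathbf{nil}\sqcap c;x$, $c^\omega=\mu x.\,\mathbf{nil}\sqcap c;x$. Tests $\mathcal{T}$ and atomic steps $\mathcal{A}$ (least element $\alpha$) are Boolean sub-algebras. Parallel $\parallel$ and weak conjunction $\Cap$ are synchronisation operators (associative, commutative, distributing over non-empty choices, $(a;c)\otimes(b;d)=(a\otimes b);(c\otimes d)$ for atomic $a,b$, $\mathbf{nil}\otimes\mathbf{nil}=\mathbf{nil}$, $(a;c)\otimes\mathbf{nil}=\top$, $(t;c)\otimes(t;d)=t;(c\otimes d)$ for tests $t$); $\parallel$ has atomic identity $\epsilon$ (the least environment step) and identity $\mathbf{skip}=\epsilon^\omega$; $\Cap$ has atomic identity $\alpha$, identity $\mathbf{chaos}=\alpha^\omega$, and is idempotent. The most general terminating command is $\mathbf{term}=\alpha^\star;\epsilon^\omega$. -}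

module Defs where

open import Level using (0ℓ)
open import Data.Product using (Σ; Σ-syntax; _×_; _,_; ∃)
open import Relation.Binary.PropositionalEquality using (_≡_)

-- Refinement order: c ⊑ d means "d refines c"; ⊓ is the meet
-- (nondeterministic choice), ⊔ the join (conjunction), ⊤ infeasible
-- (top), ⊥ abort (bottom).

record Base : Set₁ where
  infixr 30 _⨾_
  infixl 20 _⊓_
  infixl 21 _⊔_
  infix  4 _⊑_
  infix  40 ¬ₜ_ !ₐ_
  infix 45 _⋆ _ω
  field
    C    : Set
    _⊑_  : C → C → Set
    ⊑-refl    : ∀ {c} → c ⊑ c
    ⊑-trans   : ∀ {c d e} → c ⊑ d → d ⊑ e → c ⊑ e
    ⊑-antisym : ∀ {c d} → c ⊑ d → d ⊑ c → c ≡ d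

    ⨅    : {I : Set} → (I → C) → C
    ⨅-lower    : ∀ {I} (f : I → C) (i : I) → ⨅ f ⊑ f i
    ⨅-greatest : ∀ {I} (f : I → C) {x} → (∀ i → x ⊑ f i) → x ⊑ ⨅ f
    _⊓_  : C → C → C
    ⊓-lowerˡ  : ∀ c d → c ⊓ d ⊑ c
    ⊓-lowerʳ  : ∀ c d → c ⊓ d ⊑ d
    ⊓-greatest : ∀ {c d x} → x ⊑ c → x ⊑ d → x ⊑ c ⊓ d
    _⊔_  : C → C → C
    ⊔-upperˡ  : ∀ c d → c ⊑ c ⊔ d
    ⊔-upperʳ  : ∀ c d → d ⊑ c ⊔ d
    ⊔-least   : ∀ {c d x} → c ⊑ x → d ⊑ x → c ⊔ d ⊑ x
    ⊤ ⊥  : C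
    ⊤-max : ∀ c → c ⊑ ⊤
    ⊥-min : ∀ c → ⊥ ⊑ c
    ⊓-distrib-⊔ : ∀ c d e → c ⊓ (d ⊔ e) ≡ (c ⊓ d) ⊔ (c ⊓ e)
    ⊔-distrib-⊓ : ∀ c d e → c ⊔ (d ⊓ e) ≡ (c ⊔ d) ⊓ (c ⊔ e)

    _⨾_  : C → C → C
    nil  : C
    ⨾-assoc    : ∀ c d e → (c ⨾ d) ⨾ e ≡ c ⨾ (d ⨾ e)
    ⨾-identityˡ : ∀ c → nil ⨾ c ≡ c
    ⨾-identityʳ : ∀ c → c ⨾ nil ≡ c
    -- ; distributes over arbitrary choice on the left, non-empty on the right
    ⨾-distribʳ-⨅ : ∀ {I} (f : I → C) d → ⨅ f ⨾ d ≡ ⨅ (λ i → f i ⨾ d)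
    ⨾-distribˡ-⨅ : ∀ {I} (f : I → C) c → I → c ⨾ ⨅ f ≡ ⨅ (λ i → c ⨾ f i)

    -- iterations: c⋆ = νx. nil ⊓ c;x , cω = μx. nil ⊓ c;x
    _⋆ _ω : C → C
    ⋆-unfold : ∀ c → c ⋆ ≡ nil ⊓ c ⨾ c ⋆
    ⋆-induct : ∀ c x → x ⊑ nil ⊓ c ⨾ x → x ⊑ c ⋆
    ω-unfold : ∀ c → c ω ≡ nil ⊓ c ⨾ c ω
    ω-induct : ∀ c x → nil ⊓ c ⨾ x ⊑ x → c ω ⊑ x

    Test : C → Set
    test-nil : Test nil
    test-⊤   : Test ⊤
    test-⊓   : ∀ {t u} → Test t → Test u → Test (t ⊓ u)
    test-⊔   : ∀ {t u} → Test t → Test u → Test (t ⊔ u)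
    ¬ₜ_      : C → C
    test-¬   : ∀ {t} → Test t → Test (¬ₜ t)
    test-¬-⊓ : ∀ {t} → Test t → t ⊓ ¬ₜ t ≡ nil
    test-¬-⊔ : ∀ {t} → Test t → t ⊔ ¬ₜ t ≡ ⊤
    test-⨾   : ∀ {t u} → Test t → Test u → t ⨾ u ≡ t ⊔ u

    Atomic : C → Set
    α        : C
    atomic-α : Atomic α
    α-min    : ∀ {a} → Atomic a → α ⊑ a
    atomic-⊤ : Atomic ⊤
    atomic-⊓ : ∀ {a b} → Atomic a → Atomic b → Atomic (a ⊓ b)
    atomic-⊔ : ∀ {a b} → Atomic a → Atomic b → Atomic (a ⊔ b)
    !ₐ_        : C → C
    atomic-!   : ∀ {a} → Atomic a → Atomic (!ₐ a)
    atomic-!-⊓ : ∀ {a} → Atomic a → a ⊓ !ₐ a ≡ α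
    atomic-!-⊔ : ∀ {a} → Atomic a → a ⊔ !ₐ a ≡ ⊤
    ε        : C
    atomic-ε : Atomic ε


module Derived (B : Base) where
  open Base B

  record IsSync (_⊗_ : C → C → C) : Set₁ where
    field
      assoc : ∀ c d e → (c ⊗ d) ⊗ e ≡ c ⊗ (d ⊗ e)
      comm  : ∀ c d → c ⊗ d ≡ d ⊗ c
      -- distributes over non-empty choices (index type inhabited)
      distrib-⨅ : ∀ {I} (f : I → C) d → I → ⨅ f ⊗ d ≡ ⨅ (λ i → f i ⊗ d)
      atomic-closed : ∀ {a b} → Atomic a → Atomic b → Atomic (a ⊗ b)
      step : ∀ {a b} c d → Atomic a → Atomic b →
             (a ⨾ c) ⊗ (b ⨾ d) ≡ (a ⊗ b) ⨾ (c ⊗ d)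
      nil-nil  : nil ⊗ nil ≡ nil
      step-nil : ∀ {a} c → Atomic a → (a ⨾ c) ⊗ nil ≡ ⊤
      test     : ∀ {t} c d → Test t → (t ⨾ c) ⊗ (t ⨾ d) ≡ t ⨾ (c ⊗ d)

  skip chaos term : C
  skip  = ε ω
  chaos = α ω
  term  = α ⋆ ⨾ ε ω

record CRA : Set₁ where
  field
    base : Base
  private module B = Base base
  private module D = Derived base
  field
    _∥_ _⋒_ : B.C → B.C → B.C
    ∥-sync : D.IsSync _∥_
    ∥-atomic-identity : ∀ {a} → B.Atomic a → a ∥ B.ε ≡ a
    ∥-identity        : ∀ c → c ∥ D.skip ≡ c
    ⋒-sync : D.IsSync _⋒_
    ⋒-atomic-identity : ∀ {a} → B.Atomic a → a ⋒ B.α ≡ a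
    ⋒-identity        : ∀ c → c ⋒ D.chaos ≡ c
    ⋒-idem            : ∀ c → c ⋒ c ≡ c
  infixl 25 _∥_ _⋒_
  open Base base public
  open Derived base public

  spec : (q : C × C → Set) → C
  spec q = ⨅ {Σ[ p ∈ C × C ] q p} (λ { ((t₁ , t₂) , _) → t₁ ⨾ term ⨾ t₂ })

  SetOfTestPairs : (C × C → Set) → Set
  SetOfTestPairs q = ∀ {t₁ t₂} → q (t₁ , t₂) → Test t₁ × Test t₂

-- Weak conjunction with term: term refines every t₁ ; term ; t₂, so it refines
-- [q], and [q] ⋒ term lies between [q] ⋒ chaos = [q] and [q] ⋒ [q] = [q].
--
-- Parallel with term: since term ⊑ skip we get [q] ∥ term ⊑ [q], and as ∥
-- distributes over the choice it suffices that X ⊑ X ∥ term for each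
-- X = t₁ ; term ; t₂.  Splitting term on t₁, the branch t₁ ; term
-- synchronises with the leading test of X, while ¬t₁ ; term is infeasible
-- against it.  What remains is α⋆ ; skip ; t₂ ⊑ (α⋆ ; skip ; t₂) ∥ term;
-- writing α⋆ as the meet of its finite powers αⁿ, this becomes
-- α⋆ ; skip ; t₂ ⊑ (αⁿ ; skip ; t₂) ∥ (αᵐ ; skip), by induction on n and m:
-- matching α-steps pair up as α ⊑ α ∥ α, and leftover α-steps on the right
-- are absorbed by the environment steps of the skip on the left.
module Submission where

open import Defs
open import Data.Bool using (Bool; true; false; if_then_else_)
open import Data.Empty using (⊥-elim) renaming (⊥ to Empty)
open import Data.Maybe using (just; nothing; maybe)
open import Data.Nat using (ℕ; zero; suc)
open import Data.Product using (_×_; _,_; proj₁; proj₂)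
open import Relation.Binary.Bundles using (Poset)
open import Relation.Binary.PropositionalEquality
  using (_≡_; refl; sym; trans; cong; cong₂; isEquivalence; module ≡-Reasoning)
import Relation.Binary.Reasoning.PartialOrder as PartialOrderReasoning

module SequentialLemmas (B : Base) where
  open Base B

  ⊑-reflexive : ∀ {c d} → c ≡ d → c ⊑ d
  ⊑-reflexive refl = ⊑-refl

  ⊑-poset : Poset _ _ _
  ⊑-poset = record
    { Carrier = C ; _≈_ = _≡_ ; _≤_ = _⊑_
    ; isPartialOrder = record
      { isPreorder = record
        { isEquivalence = isEquivalence ; reflexive = ⊑-reflexive ; trans = ⊑-trans }
      ; antisym = ⊑-antisym } }

  module ⊑-Reasoning = PartialOrderReasoning ⊑-poset

  ⨅-mono : ∀ {I} {f g : I → C} → (∀ i → f i ⊑ g i) → ⨅ f ⊑ ⨅ g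
  ⨅-mono {f = f} {g} f⊑g = ⨅-greatest g (λ i → ⊑-trans (⨅-lower f i) (f⊑g i))

  ⨅-cong : ∀ {I} {f g : I → C} → (∀ i → f i ≡ g i) → ⨅ f ≡ ⨅ g
  ⨅-cong f≡g = ⊑-antisym (⨅-mono (λ i → ⊑-reflexive (f≡g i)))
                         (⨅-mono (λ i → ⊑-reflexive (sym (f≡g i))))

  ⊓-as-⨅ : ∀ c d → c ⊓ d ≡ ⨅ (λ b → if b then c else d)
  ⊓-as-⨅ c d = ⊑-antisym
    (⨅-greatest _ (λ { true → ⊓-lowerˡ c d ; false → ⊓-lowerʳ c d }))
    (⊓-greatest (⨅-lower _ true) (⨅-lower _ false))

  ⊤-as-⨅ : (f : Empty → C) → ⊤ ≡ ⨅ f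
  ⊤-as-⨅ f = ⊑-antisym (⨅-greatest f (λ ())) (⊤-max _)

  ⊓-homo : (F : C → C) → (∀ (f : Bool → C) → F (⨅ f) ≡ ⨅ (λ b → F (f b))) →
           ∀ c d → F (c ⊓ d) ≡ F c ⊓ F d
  ⊓-homo F F-⨅ c d = begin
    F (c ⊓ d)                          ≡⟨ cong F (⊓-as-⨅ c d) ⟩
    F (⨅ (λ b → if b then c else d))   ≡⟨ F-⨅ _ ⟩
    ⨅ (λ b → F (if b then c else d))   ≡⟨ ⨅-cong (λ { true → refl ; false → refl }) ⟩
    ⨅ (λ b → if b then F c else F d)   ≡⟨ ⊓-as-⨅ (F c) (F d) ⟨
    F c ⊓ F d                          ∎
    where open ≡-Reasoning

  ⊓-homo⇒mono : (F : C → C) → (∀ c d → F (c ⊓ d) ≡ F c ⊓ F d) →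
                ∀ {c d} → c ⊑ d → F c ⊑ F d
  ⊓-homo⇒mono F F-⊓ {c} {d} c⊑d = begin
    F c        ≡⟨ cong F (⊑-antisym (⊓-greatest ⊑-refl c⊑d) (⊓-lowerˡ c d)) ⟩
    F (c ⊓ d)  ≡⟨ F-⊓ c d ⟩
    F c ⊓ F d  ≤⟨ ⊓-lowerʳ _ _ ⟩
    F d        ∎
    where open ⊑-Reasoning

  ⨾-distribʳ-⊓ : ∀ c d e → (c ⊓ d) ⨾ e ≡ c ⨾ e ⊓ d ⨾ e
  ⨾-distribʳ-⊓ c d e = ⊓-homo (_⨾ e) (λ f → ⨾-distribʳ-⨅ f e) c d

  ⨾-distribˡ-⊓ : ∀ c d e → e ⨾ (c ⊓ d) ≡ e ⨾ c ⊓ e ⨾ d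
  ⨾-distribˡ-⊓ c d e = ⊓-homo (e ⨾_) (λ f → ⨾-distribˡ-⨅ f e true) c d

  ⨾-monoˡ : ∀ {c d} e → c ⊑ d → c ⨾ e ⊑ d ⨾ e
  ⨾-monoˡ e = ⊓-homo⇒mono (_⨾ e) (λ c d → ⨾-distribʳ-⊓ c d e)

  ⨾-monoʳ : ∀ {c d} e → c ⊑ d → e ⨾ c ⊑ e ⨾ d
  ⨾-monoʳ e = ⊓-homo⇒mono (e ⨾_) (λ c d → ⨾-distribˡ-⊓ c d e)

  ⨾-zeroˡ : ∀ c → ⊤ ⨾ c ≡ ⊤
  ⨾-zeroˡ c = begin
    ⊤ ⨾ c                          ≡⟨ cong (_⨾ c) (⊤-as-⨅ ⊥-elim) ⟩
    ⨅ ⊥-elim ⨾ c                   ≡⟨ ⨾-distribʳ-⨅ ⊥-elim c ⟩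
    ⨅ (λ i → ⊥-elim i ⨾ c)         ≡⟨ ⊤-as-⨅ _ ⟨
    ⊤                              ∎
    where open ≡-Reasoning

  ⊔-comm : ∀ c d → c ⊔ d ≡ d ⊔ c
  ⊔-comm c d = ⊑-antisym (⊔-least (⊔-upperʳ d c) (⊔-upperˡ d c))
                         (⊔-least (⊔-upperʳ c d) (⊔-upperˡ c d))

  ⨅-adjoin-⊤ : ∀ {I} (f : I → C) → ⨅ f ≡ ⨅ (maybe f ⊤)
  ⨅-adjoin-⊤ f = ⊑-antisym
    (⨅-greatest _ (λ { nothing → ⊤-max _ ; (just i) → ⨅-lower f i }))
    (⨅-greatest f (λ i → ⨅-lower (maybe f ⊤) (just i)))

  nil⊑test : ∀ {t} → Test t → nil ⊑ t
  nil⊑test {t} t-test = ⊑-trans (⊑-reflexive (sym (test-¬-⊓ t-test))) (⊓-lowerˡ t (¬ₜ t))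

  ⊑-test⨾ : ∀ {t} c → Test t → c ⊑ t ⨾ c
  ⊑-test⨾ c t-test = ⊑-trans (⊑-reflexive (sym (⨾-identityˡ c))) (⨾-monoˡ c (nil⊑test t-test))

  ⊑-⨾test : ∀ {t} c → Test t → c ⊑ c ⨾ t
  ⊑-⨾test c t-test = ⊑-trans (⊑-reflexive (sym (⨾-identityʳ c))) (⨾-monoʳ c (nil⊑test t-test))

  test-split : ∀ {t} c → Test t → c ≡ t ⨾ c ⊓ ¬ₜ t ⨾ c
  test-split {t} c t-test = begin
    c                    ≡⟨ ⨾-identityˡ c ⟨
    nil ⨾ c              ≡⟨ cong (_⨾ c) (test-¬-⊓ t-test) ⟨
    (t ⊓ ¬ₜ t) ⨾ c       ≡⟨ ⨾-distribʳ-⊓ t (¬ₜ t) c ⟩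
    t ⨾ c ⊓ ¬ₜ t ⨾ c     ∎
    where open ≡-Reasoning

  test⨾compl : ∀ {t} → Test t → t ⨾ ¬ₜ t ≡ ⊤
  test⨾compl t-test = trans (test-⨾ t-test (test-¬ t-test)) (test-¬-⊔ t-test)

  compl⨾test : ∀ {t} → Test t → ¬ₜ t ⨾ t ≡ ⊤
  compl⨾test {t} t-test = trans (test-⨾ (test-¬ t-test) t-test)
                                (trans (⊔-comm (¬ₜ t) t) (test-¬-⊔ t-test))

  ⊔-compl-guards : ∀ {t} c d → Test t → t ⨾ c ⊔ ¬ₜ t ⨾ d ≡ ⊤
  ⊔-compl-guards {t} c d t-test = ⊑-antisym (⊤-max _) (begin
    ⊤                    ≤⟨ ⊓-greatest (infeasible-after t d (test⨾compl t-test) (⊔-upperʳ _ _))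
                                       (infeasible-after (¬ₜ t) c (compl⨾test t-test) (⊔-upperˡ _ _)) ⟩
    t ⨾ W ⊓ ¬ₜ t ⨾ W     ≡⟨ test-split W t-test ⟨
    W                    ∎)
    where
    open ⊑-Reasoning
    W : C
    W = t ⨾ c ⊔ ¬ₜ t ⨾ d
    infeasible-after : ∀ u {v} e → u ⨾ v ≡ ⊤ → v ⨾ e ⊑ W → ⊤ ⊑ u ⨾ W
    infeasible-after u {v} e uv≡⊤ ve⊑W = begin
      ⊤              ≡⟨ ⨾-zeroˡ e ⟨
      ⊤ ⨾ e          ≡⟨ cong (_⨾ e) uv≡⊤ ⟨
      (u ⨾ v) ⨾ e    ≡⟨ ⨾-assoc u v e ⟩
      u ⨾ (v ⨾ e)    ≤⟨ ⨾-monoʳ u ve⊑W ⟩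
      u ⨾ W          ∎

  unfold-⨾ : ∀ {x c} d → x ≡ nil ⊓ c ⨾ x → x ⨾ d ≡ d ⊓ c ⨾ (x ⨾ d)
  unfold-⨾ {x} {c} d x-unfold = begin
    x ⨾ d                    ≡⟨ cong (_⨾ d) x-unfold ⟩
    (nil ⊓ c ⨾ x) ⨾ d        ≡⟨ ⨾-distribʳ-⊓ nil (c ⨾ x) d ⟩
    nil ⨾ d ⊓ (c ⨾ x) ⨾ d    ≡⟨ cong₂ _⊓_ (⨾-identityˡ d) (⨾-assoc c x d) ⟩
    d ⊓ c ⨾ (x ⨾ d)          ∎
    where open ≡-Reasoning

  infixr 35 _^_
  _^_ : C → ℕ → C
  c ^ zero  = nil
  c ^ suc n = c ⨾ c ^ n

  ⋆⊑^ : ∀ c n → c ⋆ ⊑ c ^ n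
  ⋆⊑^ c zero    = ⊑-trans (⊑-reflexive (⋆-unfold c)) (⊓-lowerˡ _ _)
  ⋆⊑^ c (suc n) = ⊑-trans (⊑-reflexive (⋆-unfold c))
                          (⊑-trans (⊓-lowerʳ _ _) (⨾-monoʳ c (⋆⊑^ c n)))

  ⨅^⊑⋆ : ∀ c → ⨅ (c ^_) ⊑ c ⋆
  ⨅^⊑⋆ c = ⋆-induct c (⨅ (c ^_)) (⊓-greatest (⨅-lower (c ^_) zero) (begin
    ⨅ (c ^_)                  ≤⟨ ⨅-greatest _ (λ n → ⨅-lower (c ^_) (suc n)) ⟩
    ⨅ (λ n → c ⨾ c ^ n)       ≡⟨ ⨾-distribˡ-⨅ (c ^_) c zero ⟨
    c ⨾ ⨅ (c ^_)              ∎))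
    where open ⊑-Reasoning

  ⋆⨾-as-⨅ : ∀ c d → c ⋆ ⨾ d ≡ ⨅ (λ n → c ^ n ⨾ d)
  ⋆⨾-as-⨅ c d = ⊑-antisym
    (⨅-greatest _ (λ n → ⨾-monoˡ d (⋆⊑^ c n)))
    (⊑-trans (⊑-reflexive (sym (⨾-distribʳ-⨅ (c ^_) d))) (⨾-monoˡ d (⨅^⊑⋆ c)))

module SyncLemmas (B : Base)
                  (_⊗_ : Base.C B → Base.C B → Base.C B) (⊗-sync : Derived.IsSync B _⊗_) where
  open Base B
  open Derived.IsSync ⊗-sync
  open SequentialLemmas B

  distribˡ-⨅ : ∀ {I} (f : I → C) d → I → d ⊗ ⨅ f ≡ ⨅ (λ i → d ⊗ f i)
  distribˡ-⨅ f d i =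
    trans (comm d (⨅ f)) (trans (distrib-⨅ f d i) (⨅-cong (λ j → comm (f j) d)))

  distribʳ-⊓ : ∀ c d e → (c ⊓ d) ⊗ e ≡ (c ⊗ e) ⊓ (d ⊗ e)
  distribʳ-⊓ c d e = ⊓-homo (_⊗ e) (λ f → distrib-⨅ f e true) c d

  distribˡ-⊓ : ∀ c d e → e ⊗ (c ⊓ d) ≡ (e ⊗ c) ⊓ (e ⊗ d)
  distribˡ-⊓ c d e = ⊓-homo (e ⊗_) (λ f → distribˡ-⨅ f e true) c d

  monoˡ : ∀ {c d} e → c ⊑ d → c ⊗ e ⊑ d ⊗ e
  monoˡ e = ⊓-homo⇒mono (_⊗ e) (λ c d → distribʳ-⊓ c d e)

  monoʳ : ∀ {c d} e → c ⊑ d → e ⊗ c ⊑ e ⊗ d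
  monoʳ e = ⊓-homo⇒mono (e ⊗_) (λ c d → distribˡ-⊓ c d e)

module _ (A : CRA) where
  open CRA A
  open SequentialLemmas base
  open SyncLemmas base _⋒_ ⋒-sync using () renaming (monoʳ to ⋒-monoʳ)
  open SyncLemmas base _∥_ ∥-sync using ()
    renaming ( distribʳ-⊓ to ∥-distribʳ-⊓ ; distribˡ-⊓ to ∥-distribˡ-⊓
             ; distribˡ-⨅ to ∥-distribˡ-⨅ ; monoˡ to ∥-monoˡ ; monoʳ to ∥-monoʳ )
  open IsSync ∥-sync using ()
    renaming ( assoc to ∥-assoc ; comm to ∥-comm ; distrib-⨅ to ∥-distribʳ-⨅
             ; atomic-closed to ∥-atomic-closed ; step to ∥-step ; step-nil to ∥-step-nil
             ; test to ∥-test )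

  term-unfold : term ≡ skip ⊓ α ⨾ term
  term-unfold = unfold-⨾ skip (⋆-unfold α)

  term⊑skip : term ⊑ skip
  term⊑skip = ⊑-trans (⊑-reflexive term-unfold) (⊓-lowerˡ _ _)

  chaos⊑term : chaos ⊑ term
  chaos⊑term = ω-induct α term (begin
    nil ⊓ α ⨾ term    ≤⟨ ⊓-greatest nil⊓αterm⊑skip (⊓-lowerʳ _ _) ⟩
    skip ⊓ α ⨾ term   ≡⟨ term-unfold ⟨
    term              ∎)
    where
    open ⊑-Reasoning
    nil⊓αterm⊑skip : nil ⊓ α ⨾ term ⊑ skip
    nil⊓αterm⊑skip = begin
      nil ⊓ α ⨾ term   ≤⟨ ⊓-greatest (⊓-lowerˡ _ _)
                            (⊑-trans (⊓-lowerʳ _ _) (⨾-monoˡ term (α-min atomic-ε))) ⟩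
      nil ⊓ ε ⨾ term   ≤⟨ ⊓-greatest (⊓-lowerˡ _ _) (⊑-trans (⊓-lowerʳ _ _) (⨾-monoʳ ε term⊑skip)) ⟩
      nil ⊓ ε ⨾ skip   ≡⟨ ω-unfold ε ⟨
      skip             ∎

  term⊑spec : (q : C × C → Set) → SetOfTestPairs q → term ⊑ spec q
  term⊑spec q q-tests = ⨅-greatest _ λ { ((t₁ , t₂) , p) →
    ⊑-trans (⊑-test⨾ term (proj₁ (q-tests p))) (⨾-monoʳ t₁ (⊑-⨾test term (proj₂ (q-tests p)))) }

  ⋒-term-absorb : ∀ {c} → term ⊑ c → c ⋒ term ≡ c
  ⋒-term-absorb {c} term⊑c = ⊑-antisym
    (⊑-trans (⋒-monoʳ c term⊑c) (⊑-reflexive (⋒-idem c)))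
    (⊑-trans (⊑-reflexive (sym (⋒-identity c))) (⋒-monoʳ c chaos⊑term))

  ∥-term-⊑ : ∀ c → c ∥ term ⊑ c
  ∥-term-⊑ c = ⊑-trans (∥-monoʳ c term⊑skip) (⊑-reflexive (∥-identity c))

  test∥step : ∀ {t a} c → Test t → Atomic a → t ∥ (a ⨾ c) ≡ ⊤
  test∥step {t} {a} c t-test a-atomic = ⊑-antisym (⊤-max _) (begin
    ⊤               ≡⟨ ∥-step-nil c a-atomic ⟨
    (a ⨾ c) ∥ nil   ≡⟨ ∥-comm (a ⨾ c) nil ⟩
    nil ∥ (a ⨾ c)   ≤⟨ ∥-monoˡ (a ⨾ c) (nil⊑test t-test) ⟩
    t ∥ (a ⨾ c)     ∎)
    where open ⊑-Reasoning

  ⊤∥term : ⊤ ∥ term ≡ ⊤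
  ⊤∥term = ⊑-antisym (⊤-max _) (begin
    ⊤                               ≤⟨ ⊓-greatest (⊑-reflexive (sym (∥-identity ⊤)))
                                                  (⊑-reflexive (sym (test∥step term test-⊤ atomic-α))) ⟩
    ⊤ ∥ skip ⊓ ⊤ ∥ (α ⨾ term)       ≡⟨ ∥-distribˡ-⊓ skip (α ⨾ term) ⊤ ⟨
    ⊤ ∥ (skip ⊓ α ⨾ term)           ≡⟨ cong (⊤ ∥_) term-unfold ⟨
    ⊤ ∥ term                        ∎)
    where open ⊑-Reasoning

  ⊤∥-above-term : ∀ {c} → term ⊑ c → ⊤ ∥ c ≡ ⊤
  ⊤∥-above-term {c} term⊑c =
    ⊑-antisym (⊤-max _) (⊑-trans (⊑-reflexive (sym ⊤∥term)) (∥-monoʳ ⊤ term⊑c))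

  test⨾-∥-test⨾skip : ∀ {t} c → Test t → (t ⨾ c) ∥ (t ⨾ skip) ≡ t ⨾ c
  test⨾-∥-test⨾skip {t} c t-test = trans (∥-test c skip t-test) (cong (t ⨾_) (∥-identity c))

  ⊑-∥-test⨾skip : ∀ {t} c → Test t → c ⊑ c ∥ (t ⨾ skip)
  ⊑-∥-test⨾skip c t-test =
    ⊑-trans (⊑-reflexive (sym (∥-identity c))) (∥-monoʳ c (⊑-test⨾ skip t-test))

  compl-guarded-skips : ∀ {t} → Test t → (t ⨾ skip) ∥ (¬ₜ t ⨾ skip) ≡ ⊤
  compl-guarded-skips {t} t-test = ⊑-antisym (⊤-max _) (begin
    ⊤                            ≡⟨ ⊔-compl-guards skip skip t-test ⟨
    t ⨾ skip ⊔ ¬ₜ t ⨾ skip       ≤⟨ ⊔-least (⊑-∥-test⨾skip (t ⨾ skip) (test-¬ t-test))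
                                           (⊑-trans (⊑-∥-test⨾skip (¬ₜ t ⨾ skip) t-test)
                                                    (⊑-reflexive (∥-comm _ _))) ⟩
    (t ⨾ skip) ∥ (¬ₜ t ⨾ skip)   ∎)
    where open ⊑-Reasoning

  compl-guards-∥ : ∀ {t} c d → Test t → term ⊑ c → term ⊑ d → (t ⨾ c) ∥ (¬ₜ t ⨾ d) ≡ ⊤
  compl-guards-∥ {t} c d t-test term⊑c term⊑d = begin
    (t ⨾ c) ∥ (¬ₜ t ⨾ d)
      ≡⟨ cong₂ _∥_ (test⨾-∥-test⨾skip c t-test)
                   (trans (∥-comm _ _) (test⨾-∥-test⨾skip d (test-¬ t-test))) ⟨
    ((t ⨾ c) ∥ (t ⨾ skip)) ∥ ((¬ₜ t ⨾ skip) ∥ (¬ₜ t ⨾ d))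
      ≡⟨ ∥-assoc _ _ _ ⟩
    (t ⨾ c) ∥ ((t ⨾ skip) ∥ ((¬ₜ t ⨾ skip) ∥ (¬ₜ t ⨾ d)))
      ≡⟨ cong ((t ⨾ c) ∥_) (∥-assoc _ _ _) ⟨
    (t ⨾ c) ∥ (((t ⨾ skip) ∥ (¬ₜ t ⨾ skip)) ∥ (¬ₜ t ⨾ d))
      ≡⟨ cong (λ x → (t ⨾ c) ∥ (x ∥ (¬ₜ t ⨾ d))) (compl-guarded-skips t-test) ⟩
    (t ⨾ c) ∥ (⊤ ∥ (¬ₜ t ⨾ d))
      ≡⟨ cong ((t ⨾ c) ∥_) (⊤∥-above-term (⊑-trans term⊑d (⊑-test⨾ d (test-¬ t-test)))) ⟩
    (t ⨾ c) ∥ ⊤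
      ≡⟨ trans (∥-comm _ _) (⊤∥-above-term (⊑-trans term⊑c (⊑-test⨾ c t-test))) ⟩
    ⊤ ∎
    where open ≡-Reasoning

  test⨾-∥-term : ∀ {t c} → Test t → term ⊑ c → c ⊑ c ∥ term → t ⨾ c ⊑ (t ⨾ c) ∥ term
  test⨾-∥-term {t} {c} t-test term⊑c c⊑c∥term = begin
    t ⨾ c                                          ≤⟨ ⊓-greatest synchronised infeasible ⟩
    (t ⨾ c) ∥ (t ⨾ term) ⊓ (t ⨾ c) ∥ (¬ₜ t ⨾ term)  ≡⟨ ∥-distribˡ-⊓ _ _ (t ⨾ c) ⟨
    (t ⨾ c) ∥ (t ⨾ term ⊓ ¬ₜ t ⨾ term)              ≡⟨ cong ((t ⨾ c) ∥_) (test-split term t-test) ⟨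
    (t ⨾ c) ∥ term                                 ∎
    where
    open ⊑-Reasoning
    synchronised : t ⨾ c ⊑ (t ⨾ c) ∥ (t ⨾ term)
    synchronised = ⊑-trans (⨾-monoʳ t c⊑c∥term) (⊑-reflexive (sym (∥-test c term t-test)))
    infeasible : t ⨾ c ⊑ (t ⨾ c) ∥ (¬ₜ t ⨾ term)
    infeasible = ⊑-trans (⊤-max _)
                         (⊑-reflexive (sym (compl-guards-∥ c term t-test term⊑c ⊑-refl)))

  term⨾test-∥-term : ∀ {t} → Test t → term ⨾ t ⊑ (term ⨾ t) ∥ term
  term⨾test-∥-term {t} t-test = begin
    term ⨾ t                                              ≡⟨ ⨾-assoc (α ⋆) skip t ⟩
    Y                                                     ≤⟨ ⨅-greatest _ (λ n → ⨅-greatest _ (interleave n)) ⟩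
    ⨅ (λ n → ⨅ (λ m → (α ^ n ⨾ k) ∥ (α ^ m ⨾ skip)))      ≡⟨ ⨅-cong (λ n → ∥-distribˡ-⨅ _ (α ^ n ⨾ k) zero) ⟨
    ⨅ (λ n → (α ^ n ⨾ k) ∥ ⨅ (λ m → α ^ m ⨾ skip))        ≡⟨ ∥-distribʳ-⨅ _ _ zero ⟨
    ⨅ (λ n → α ^ n ⨾ k) ∥ ⨅ (λ m → α ^ m ⨾ skip)          ≡⟨ cong₂ _∥_ (⋆⨾-as-⨅ α k) (⋆⨾-as-⨅ α skip) ⟨
    Y ∥ term                                              ≡⟨ cong (_∥ term) (⨾-assoc (α ⋆) skip t) ⟨
    (term ⨾ t) ∥ term                                     ∎
    where
    open ⊑-Reasoning
    k Y : C
    k = skip ⨾ t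
    Y = α ⋆ ⨾ k

    Y-unfold : Y ≡ k ⊓ α ⨾ Y
    Y-unfold = unfold-⨾ k (⋆-unfold α)

    k-unfold : k ≡ t ⊓ ε ⨾ k
    k-unfold = unfold-⨾ t (ω-unfold ε)

    Y⊑αY : Y ⊑ α ⨾ Y
    Y⊑αY = ⊑-trans (⊑-reflexive Y-unfold) (⊓-lowerʳ _ _)

    interleave : ∀ n m → Y ⊑ (α ^ n ⨾ k) ∥ (α ^ m ⨾ skip)
    interleave n zero = begin
      Y                         ≤⟨ ⨾-monoˡ k (⋆⊑^ α n) ⟩
      α ^ n ⨾ k                 ≡⟨ ∥-identity _ ⟨
      (α ^ n ⨾ k) ∥ skip        ≡⟨ cong ((α ^ n ⨾ k) ∥_) (⨾-identityˡ skip) ⟨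
      (α ^ n ⨾ k) ∥ (nil ⨾ skip) ∎
    -- The right side's step α is matched by an environment step of k's skip
    -- (ε ∥ α = α), while k terminating through t instead is infeasible.
    interleave zero (suc m) = begin
      Y                               ≤⟨ ⊓-greatest (⊤-max Y) (⊑-trans Y⊑αY (⨾-monoʳ α (interleave zero m))) ⟩
      ⊤ ⊓ α ⨾ ((nil ⨾ k) ∥ B)         ≡⟨ cong₂ _⊓_ (test∥step B t-test atomic-α) environment-step ⟨
      t ∥ (α ⨾ B) ⊓ (ε ⨾ k) ∥ (α ⨾ B) ≡⟨ ∥-distribʳ-⊓ t (ε ⨾ k) (α ⨾ B) ⟨
      (t ⊓ ε ⨾ k) ∥ (α ⨾ B)           ≡⟨ cong₂ _∥_ (trans (⨾-identityˡ k) k-unfold) (⨾-assoc α (α ^ m) skip) ⟨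
      (nil ⨾ k) ∥ (α ^ suc m ⨾ skip)  ∎
      where
      B : C
      B = α ^ m ⨾ skip
      environment-step : (ε ⨾ k) ∥ (α ⨾ B) ≡ α ⨾ ((nil ⨾ k) ∥ B)
      environment-step = begin-equality
        (ε ⨾ k) ∥ (α ⨾ B)     ≡⟨ ∥-step k B atomic-ε atomic-α ⟩
        (ε ∥ α) ⨾ (k ∥ B)     ≡⟨ cong (_⨾ (k ∥ B)) (∥-comm ε α) ⟩
        (α ∥ ε) ⨾ (k ∥ B)     ≡⟨ cong (_⨾ (k ∥ B)) (∥-atomic-identity atomic-α) ⟩
        α ⨾ (k ∥ B)           ≡⟨ cong (λ x → α ⨾ (x ∥ B)) (⨾-identityˡ k) ⟨
        α ⨾ ((nil ⨾ k) ∥ B)   ∎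
    interleave (suc n) (suc m) = begin
      Y                                          ≤⟨ Y⊑αY ⟩
      α ⨾ Y                                      ≤⟨ ⨾-monoʳ α (interleave n m) ⟩
      α ⨾ ((α ^ n ⨾ k) ∥ (α ^ m ⨾ skip))         ≤⟨ ⨾-monoˡ _ (α-min (∥-atomic-closed atomic-α atomic-α)) ⟩
      (α ∥ α) ⨾ ((α ^ n ⨾ k) ∥ (α ^ m ⨾ skip))   ≡⟨ ∥-step _ _ atomic-α atomic-α ⟨
      (α ⨾ α ^ n ⨾ k) ∥ (α ⨾ α ^ m ⨾ skip)       ≡⟨ cong₂ _∥_ (⨾-assoc α (α ^ n) k) (⨾-assoc α (α ^ m) skip) ⟨
      (α ^ suc n ⨾ k) ∥ (α ^ suc m ⨾ skip)       ∎

  -- Adjoining ⊤ makes the choice non-empty, so that ∥ distributes over it.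
  ⨅-∥-term : ∀ {I} (f : I → C) → (∀ i → f i ⊑ f i ∥ term) → ⨅ f ⊑ ⨅ f ∥ term
  ⨅-∥-term f f⊑f∥term = begin
    ⨅ f                              ≡⟨ ⨅-adjoin-⊤ f ⟩
    ⨅ (maybe f ⊤)                    ≤⟨ ⨅-mono (λ { nothing → ⊑-reflexive (sym ⊤∥term) ; (just i) → f⊑f∥term i }) ⟩
    ⨅ (λ j → maybe f ⊤ j ∥ term)     ≡⟨ ∥-distribʳ-⨅ (maybe f ⊤) term nothing ⟨
    ⨅ (maybe f ⊤) ∥ term             ≡⟨ cong (_∥ term) (⨅-adjoin-⊤ f) ⟨
    ⨅ f ∥ term                       ∎
    where open ⊑-Reasoning

  spec-∥-term : (q : C × C → Set) → SetOfTestPairs q → spec q ∥ term ≡ spec q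
  spec-∥-term q q-tests = ⊑-antisym (∥-term-⊑ (spec q)) (⨅-∥-term _ λ { ((t₁ , t₂) , p) →
    test⨾-∥-term (proj₁ (q-tests p)) (⊑-⨾test term (proj₂ (q-tests p)))
                 (term⨾test-∥-term (proj₂ (q-tests p))) })

mainTheorem12 : (A : CRA) → let open CRA A in
    (q : C × C → Set) → SetOfTestPairs q →
    (spec q ⋒ term ≡ spec q) × (spec q ∥ term ≡ spec q)
mainTheorem12 A q q-tests = ⋒-term-absorb A (term⊑spec A q q-tests) , spec-∥-term A q q-tests
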